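{- Let $T$ be a tournament and $A$ a subset of $V(T)$ with $|A|\ge 4$. Then $A$ is an acyclic component of $T$ if and only if $A$ is a monomorphic component of $T$.
   Context: A tournament is a set with an irreflexive, antisymmetric, complete binary relation; acyclic means no $3$-cycle. A subset $B$ of vertices is autonomous if for all $x,x'\in B$ and $y\notin B$, $(x,y)$ is an edge iff $(x',y)$ is an edge. The acyclic component of a vertex $x$ is the union of all acyclic autonomous subsets containing $x$. A subset $B\subseteq V(T)$ is a monomorphic part of $T$ if for every integer $n$ and all $n$-element subsets $X,X'$ of $V(T)$ with $X\setminus B=X'\setminus B$, the induced tournaments on $X$ and $X'$ are isomorphic. For $x\in V(T)$, the monomorphic component of $x$ is the union of all monomorphic parts containing $x$ (it is the largest monomorphic part containing $x$); a monomorphic component of $T$ is a set of this form. -}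

module Defs where

open import Level using (Level; 0ℓ) renaming (suc to lsuc)
open import Data.Nat using (ℕ)
open import Data.Fin using (Fin)
open import Data.Product using (Σ; ∃; ∃-syntax; _×_; _,_)
open import Data.Sum using (_⊎_)
open import Relation.Nullary using (¬_)
open import Relation.Binary.PropositionalEquality using (_≡_; _≢_)
open import Function.Bundles using (_⇔_; _↔_; Inverse)
open import Function.Definitions using (Injective)

record Tournament (V : Set) : Set₁ where
  field
    E        : V → V → Set
    irrefl   : ∀ x → ¬ E x x
    antisym  : ∀ x y → E x y → ¬ E y x
    complete : ∀ x y → x ≢ y → E x y ⊎ E y x

Subset : Set → Set₁
Subset V = V → Set

module _ {V : Set} (T : Tournament V) where
  open Tournament T

  Acyclic : Subset V → Set
  Acyclic B = ∀ x y z → B x → B y → B z → E x y → E y z → ¬ E z x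

  Autonomous : Subset V → Set
  Autonomous B = ∀ x x' y → B x → B x' → ¬ B y → (E x y ⇔ E x' y)

  AcyclicComponentOf : V → V → Set₁
  AcyclicComponentOf x y = ∃[ B ] (Acyclic B × Autonomous B × B x × B y)

  -- An n-element subset of V, given by an injective enumeration Fin n → V
  -- (the subset is the image of the enumeration).
  record FinSubset (n : ℕ) : Set where
    field
      elt : Fin n → V
      inj : Injective _≡_ _≡_ elt
  open FinSubset public

  _∈img_ : V → ∀ {n} → FinSubset n → Set
  v ∈img X = ∃[ i ] (elt X i ≡ v)

  InducedIso : ∀ {n} → FinSubset n → FinSubset n → Set
  InducedIso {n} X X' = Σ (Fin n ↔ Fin n) λ σ → ∀ i j →
      E (elt X i) (elt X j) ⇔ E (elt X' (Inverse.to σ i)) (elt X' (Inverse.to σ j))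

  MonomorphicPart : Subset V → Set
  MonomorphicPart B = ∀ (n : ℕ) (X X' : FinSubset n) →
    (∀ v → ((v ∈img X) × ¬ B v) ⇔ ((v ∈img X') × ¬ B v)) →
    InducedIso X X'

  MonomorphicComponentOf : V → V → Set₁
  MonomorphicComponentOf x y = ∃[ B ] (MonomorphicPart B × B x × B y)

  IsAcyclicComponent : Subset V → Set₁
  IsAcyclicComponent A = ∃[ x ] (∀ y → A y ⇔ AcyclicComponentOf x y)

  IsMonomorphicComponent : Subset V → Set₁
  IsMonomorphicComponent A = ∃[ x ] (∀ y → A y ⇔ MonomorphicComponentOf x y)

AtLeast : {V : Set} → ℕ → Subset V → Set
AtLeast {V} k A = Σ (Fin k → V) λ f → Injective _≡_ _≡_ f × (∀ i → A (f i))

-- An acyclic autonomous set B is a monomorphic part: two finite sets with the same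
-- vertices outside B meet B in equally many vertices, which B orders linearly, and
-- matching them in that order (fixing the vertices outside B) is an isomorphism.
-- Conversely, let S be a set of at least four vertices inside the monomorphic
-- component of x, x ∈ S. Exchanging two vertices of a monomorphic part inside a
-- finite set does not change its isomorphism type, so a 3-cycle through s ∈ S
-- stays a 3-cycle when s is replaced by another t ∈ S. Since no vertex lies on a
-- 3-cycle with each pair taken from three vertices, S has no 3-cycle and no
-- outside vertex forms one with two vertices of S. Adding to S the vertices lying
-- strictly between two vertices of S yields an acyclic autonomous set, so S lies
-- in the acyclic component of x.
module Submission where

open import Defs
open import Level using (0ℓ; lift; lower) renaming (suc to lsuc)
open import Axiom.ExcludedMiddle using (ExcludedMiddle)
open import Function.Base using (_∘_; id)
open import Function.Bundles using (_⇔_; mk⇔; Equivalence)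
open import Function.Definitions using (Injective)
open import Data.Nat using (zero; suc)
open import Data.Nat.Properties using (n<1+n)
open import Data.Fin using (Fin; zero; suc; punchIn; punchOut)
open import Data.Fin.Properties
  using (0≢1+n; punchIn-injective; punchInᵢ≢i; punchIn-punchOut; suc-injective; pigeonhole; <⇒≢; any?; all?; ¬∀⟶∃¬)
  renaming (_≟_ to _≟ᶠ_)
open import Data.Fin.Permutation
  using (Permutation; insert; insert-punchIn; _⟨$⟩ʳ_; _⟨$⟩ˡ_; inverseʳ) renaming (id to idₚ)
open import Data.Vec.Functional using ([]; _∷_)
open import Data.Product using (Σ; ∃-syntax; _×_; _,_; proj₁; proj₂)
open import Data.Sum using (_⊎_; inj₁; inj₂)
open import Data.Empty using (⊥; ⊥-elim)
open import Relation.Nullary using (¬_; Dec; yes; no; ¬?)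
open import Relation.Nullary.Decidable using (map′; dec-yes; decidable-stable)
open import Relation.Unary using (Decidable)
open import Relation.Binary.Definitions using (DecidableEquality)
open import Relation.Binary.PropositionalEquality using (_≡_; _≢_; refl; sym; trans; cong; subst; ≢-sym)

≡⊎punchIn : ∀ {n} (i j : Fin (suc n)) → i ≡ j ⊎ ∃[ k ] (punchIn i k ≡ j)
≡⊎punchIn i j with i ≟ᶠ j
... | yes i≡j = inj₁ i≡j
... | no i≢j = inj₂ (punchOut i≢j , punchIn-punchOut i≢j)

insert-pivot : ∀ {m n} (i : Fin (suc m)) (j : Fin (suc n)) (π : Permutation m n) → insert i j π ⟨$⟩ʳ i ≡ j
insert-pivot i j π rewrite proj₂ (dec-yes (i ≟ᶠ i) refl) = refl

injection-avoids : ∀ {V : Set} {n} → DecidableEquality V → (f : Fin (suc n) → V) → Injective _≡_ _≡_ f →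
                   (g : Fin n → V) → ∃[ i ] (∀ l → f i ≢ g l)
injection-avoids {n = n} _≟_ f f-injective g with any? (λ i → all? (λ l → ¬? (f i ≟ g l)))
... | yes avoider = avoider
... | no none =
  let i , j , i<j , same = pigeonhole (n<1+n n) (proj₁ ∘ hit)
  in ⊥-elim (<⇒≢ i<j (f-injective (trans (proj₂ (hit i)) (trans (cong g same) (sym (proj₂ (hit j)))))))
  where
  hit : ∀ i → ∃[ l ] (f i ≡ g l)
  hit i = let l , ¬f≢g = ¬∀⟶∃¬ n _ (λ l → ¬? (f i ≟ g l)) (λ avoids → none (i , avoids))
          in l , decidable-stable (f i ≟ g l) ¬f≢g

module _ {V : Set} (T : Tournament V) where
  open Tournament T
  open FinSubset

  E⇒≢ : ∀ {a b} → E a b → a ≢ b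
  E⇒≢ {a} eab refl = irrefl a eab

  Cyclic : V → V → V → Set
  Cyclic a b c = (E a b × E b c × E c a) ⊎ (E b a × E c b × E a c)

  cyclic-rotate : ∀ {a b c} → Cyclic a b c → Cyclic b c a
  cyclic-rotate (inj₁ (ab , bc , ca)) = inj₁ (bc , ca , ab)
  cyclic-rotate (inj₂ (ba , cb , ac)) = inj₂ (cb , ac , ba)

  cyclic-flip : ∀ {a b c} → Cyclic a b c → Cyclic b a c
  cyclic-flip (inj₁ (ab , bc , ca)) = inj₂ (ab , ca , bc)
  cyclic-flip (inj₂ (ba , cb , ac)) = inj₁ (ba , ac , cb)

  cyclic-flip₂₃ : ∀ {a b c} → Cyclic a b c → Cyclic a c b
  cyclic-flip₂₃ = cyclic-rotate ∘ cyclic-flip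

  cyclic⇒≢ : ∀ {a b c} → Cyclic a b c → a ≢ b
  cyclic⇒≢ (inj₁ (ab , _ , _)) = E⇒≢ ab
  cyclic⇒≢ (inj₂ (ba , _ , _)) = ≢-sym (E⇒≢ ba)

  ¬cyclic-source : ∀ {w a b} → Cyclic w a b → E w a → E w b → ⊥
  ¬cyclic-source (inj₁ (_ , _ , bw)) _ wb = antisym _ _ wb bw
  ¬cyclic-source (inj₂ (aw , _ , _)) wa _ = antisym _ _ wa aw

  ¬cyclic-sink : ∀ {w a b} → Cyclic w a b → E a w → E b w → ⊥
  ¬cyclic-sink (inj₁ (wa , _ , _)) aw _ = antisym _ _ wa aw
  ¬cyclic-sink (inj₂ (_ , _ , wb)) _ bw = antisym _ _ wb bw

  -- w beats two of a, b, c or is beaten by two of them.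
  ¬cyclic-with-all-pairs : ∀ {w a b c} → Cyclic w a b → Cyclic w a c → Cyclic w b c → ⊥
  ¬cyclic-with-all-pairs {w} {a} {b} {c} wab wac wbc
    with complete w a (cyclic⇒≢ wab) | complete w b (cyclic⇒≢ wbc) | complete w c (cyclic⇒≢ (cyclic-flip₂₃ wac))
  ... | inj₁ wa | inj₁ wb | _       = ¬cyclic-source wab wa wb
  ... | inj₂ aw | inj₂ bw | _       = ¬cyclic-sink wab aw bw
  ... | inj₁ wa | inj₂ _  | inj₁ wc = ¬cyclic-source wac wa wc
  ... | inj₁ _  | inj₂ bw | inj₂ cw = ¬cyclic-sink wbc bw cw
  ... | inj₂ _  | inj₁ wb | inj₁ wc = ¬cyclic-source wbc wb wc
  ... | inj₂ aw | inj₁ _  | inj₂ cw = ¬cyclic-sink wac aw cw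

  HasSource : ∀ {n} → (Fin n → V) → Set
  HasSource g = ∃[ i ] (∀ j → j ≢ i → E (g i) (g j))

  inducedIso-source : ∀ {n} {X X' : FinSubset T n} → InducedIso T X X' → HasSource (elt X) → HasSource (elt X')
  inducedIso-source {X = X} {X'} (σ , iso) (i , beats) = σ ⟨$⟩ʳ i , λ j j≢σi →
    subst (E (elt X' (σ ⟨$⟩ʳ i)) ∘ elt X') (inverseʳ σ)
      (Equivalence.to (iso i (σ ⟨$⟩ˡ j)) (beats (σ ⟨$⟩ˡ j) (λ { refl → j≢σi (sym (inverseʳ σ)) })))

  cyclic⇒¬source : ∀ {a b c} → Cyclic a b c → ¬ HasSource (a ∷ b ∷ c ∷ [])
  cyclic⇒¬source abc (zero , beats) = ¬cyclic-source abc (beats (suc zero) λ ()) (beats (suc (suc zero)) λ ())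
  cyclic⇒¬source abc (suc zero , beats) =
    ¬cyclic-source (cyclic-rotate abc) (beats (suc (suc zero)) λ ()) (beats zero λ ())
  cyclic⇒¬source abc (suc (suc zero) , beats) =
    ¬cyclic-source (cyclic-rotate (cyclic-rotate abc)) (beats zero λ ()) (beats (suc zero) λ ())

  ¬source⇒cyclic : ∀ {a b c} → a ≢ b → b ≢ c → c ≢ a → ¬ HasSource (a ∷ b ∷ c ∷ []) → Cyclic a b c
  ¬source⇒cyclic {a} {b} {c} a≢b b≢c c≢a no-source with complete a b a≢b | complete b c b≢c | complete c a c≢a
  ... | inj₁ ab | inj₁ bc | inj₁ ca = inj₁ (ab , bc , ca)
  ... | inj₂ ba | inj₂ cb | inj₂ ac = inj₂ (ba , cb , ac)
  ... | inj₁ ab | _       | inj₂ ac =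
    ⊥-elim (no-source (zero , λ { zero 0≢0 → ⊥-elim (0≢0 refl) ; (suc zero) _ → ab ; (suc (suc zero)) _ → ac }))
  ... | inj₂ ba | inj₁ bc | _ =
    ⊥-elim (no-source (suc zero , λ { zero _ → ba ; (suc zero) 1≢1 → ⊥-elim (1≢1 refl) ; (suc (suc zero)) _ → bc }))
  ... | _       | inj₂ cb | inj₁ ca =
    ⊥-elim (no-source (suc (suc zero) ,
      λ { zero _ → ca ; (suc zero) _ → cb ; (suc (suc zero)) 2≢2 → ⊥-elim (2≢2 refl) }))

  emptyˢ : FinSubset T 0
  emptyˢ = record { elt = [] ; inj = λ { {()} } }

  addFresh : ∀ {n} (b : V) (X : FinSubset T n) → (∀ i → elt X i ≢ b) → FinSubset T (suc n)
  addFresh b X b∉X = record { elt = b ∷ elt X ; inj = injective }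
    where
    injective : Injective _≡_ _≡_ (b ∷ elt X)
    injective {zero} {zero} _ = refl
    injective {zero} {suc j} b≡Xj = ⊥-elim (b∉X j (sym b≡Xj))
    injective {suc i} {zero} Xi≡b = ⊥-elim (b∉X i Xi≡b)
    injective {suc i} {suc j} Xi≡Xj = cong suc (inj X Xi≡Xj)

  pairˢ : ∀ {a c} → a ≢ c → FinSubset T 2
  pairˢ {a} {c} a≢c = addFresh a (addFresh c emptyˢ λ ()) λ { zero → ≢-sym a≢c }

  pair-avoids : ∀ {a c b : V} → a ≢ b → c ≢ b → ∀ i → (a ∷ c ∷ []) i ≢ b
  pair-avoids a≢b _ zero = a≢b
  pair-avoids _ c≢b (suc zero) = c≢b

  monomorphic-swap : ∀ {n} {B : Subset V} → MonomorphicPart T B → ∀ {b b'} → B b → B b' →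
    (X : FinSubset T n) (b∉X : ∀ i → elt X i ≢ b) (b'∉X : ∀ i → elt X i ≢ b') →
    InducedIso T (addFresh b X b∉X) (addFresh b' X b'∉X)
  monomorphic-swap {n} {B} mono {b} {b'} Bb Bb' X b∉X b'∉X =
    mono (suc n) (addFresh b X b∉X) (addFresh b' X b'∉X) λ _ → mk⇔ (outside Bb) (outside Bb')
    where
    outside : ∀ {c c' v} → B c → (∃[ i ] ((c ∷ elt X) i ≡ v)) × ¬ B v → (∃[ i ] ((c' ∷ elt X) i ≡ v)) × ¬ B v
    outside Bc ((zero , refl) , v∉B) = ⊥-elim (v∉B Bc)
    outside Bc ((suc i , Xi≡v) , v∉B) = (suc i , Xi≡v) , v∉B

  monomorphic-swap-source : ∀ {n} {B : Subset V} → MonomorphicPart T B → ∀ {b b'} → B b → B b' →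
    (X : FinSubset T n) → (∀ i → elt X i ≢ b) → (∀ i → elt X i ≢ b') →
    HasSource (b ∷ elt X) → HasSource (b' ∷ elt X)
  monomorphic-swap-source mono {b} {b'} Bb Bb' X b∉X b'∉X =
    inducedIso-source {X = addFresh b X b∉X} {addFresh b' X b'∉X} (monomorphic-swap mono Bb Bb' X b∉X b'∉X)

  monomorphic-swap-cyclic : ∀ {B : Subset V} → MonomorphicPart T B → ∀ {b b' a c} → B b → B b' →
    a ≢ c → a ≢ b → c ≢ b → a ≢ b' → c ≢ b' → Cyclic b a c → Cyclic b' a c
  monomorphic-swap-cyclic mono Bb Bb' a≢c a≢b c≢b a≢b' c≢b' bac =
    ¬source⇒cyclic (≢-sym a≢b') a≢c c≢b' λ source →
      cyclic⇒¬source bac (monomorphic-swap-source mono Bb' Bb (pairˢ a≢c)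
        (pair-avoids a≢b' c≢b') (pair-avoids a≢b c≢b) source)

  component-swap-source : ∀ {n x s t} → MonomorphicComponentOf T x s → MonomorphicComponentOf T x t →
    (X : FinSubset T n) → (∀ i → elt X i ≢ s) → (∀ i → elt X i ≢ t) → (∀ i → elt X i ≢ x) →
    HasSource (s ∷ elt X) → HasSource (t ∷ elt X)
  component-swap-source (_ , mono , Bx , Bs) (_ , mono' , B'x , B't) X s∉X t∉X x∉X =
    monomorphic-swap-source mono' B'x B't X x∉X t∉X ∘ monomorphic-swap-source mono Bs Bx X s∉X x∉X

  -- When x is a vertex of the cycle it cannot serve as the intermediate vertex,
  -- so s and x are moved in turn.
  component-swap-cyclic-through-x : ∀ {x s t c} → MonomorphicComponentOf T x s → MonomorphicComponentOf T x t →
    s ≢ t → x ≢ c → x ≢ s → c ≢ s → x ≢ t → c ≢ t → Cyclic s x c → Cyclic t x c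
  component-swap-cyclic-through-x (_ , mono , Bx , Bs) (_ , mono' , B'x , B't) s≢t x≢c x≢s c≢s x≢t c≢t sxc =
    cyclic-flip (monomorphic-swap-cyclic mono Bs Bx (≢-sym c≢t) (≢-sym s≢t) c≢s (≢-sym x≢t) (≢-sym x≢c)
      (cyclic-rotate (cyclic-rotate
        (monomorphic-swap-cyclic mono' B'x B't c≢s (≢-sym x≢c) (≢-sym x≢s) c≢t s≢t (cyclic-rotate sxc)))))

  component-swap-cyclic : DecidableEquality V → ∀ {x s t a c} →
    MonomorphicComponentOf T x s → MonomorphicComponentOf T x t →
    a ≢ c → a ≢ s → c ≢ s → a ≢ t → c ≢ t → Cyclic s a c → Cyclic t a c
  component-swap-cyclic _≟_ {x} {s} {t} {a} {c} xs xt a≢c a≢s c≢s a≢t c≢t sac with s ≟ t | a ≟ x | c ≟ x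
  ... | yes refl | _ | _ = sac
  ... | no s≢t | yes refl | _ = component-swap-cyclic-through-x xs xt s≢t a≢c a≢s c≢s a≢t c≢t sac
  ... | no s≢t | no a≢x | yes refl =
    cyclic-flip₂₃ (component-swap-cyclic-through-x xs xt s≢t c≢a c≢s a≢s c≢t a≢t (cyclic-flip₂₃ sac))
    where c≢a = ≢-sym a≢c
  ... | no _ | no a≢x | no c≢x =
    let _ , mono , Bx , Bs = xs ; _ , mono' , B'x , B't = xt
    in monomorphic-swap-cyclic mono' B'x B't a≢c a≢x c≢x a≢t c≢t
         (monomorphic-swap-cyclic mono Bs Bx a≢c a≢s c≢s a≢x c≢x sac)

  module _ {B : Subset V} (B? : Decidable B) (B-acyclic : Acyclic T B) (B-autonomous : Autonomous T B) where

    B-transitive : ∀ {a b c} → B a → B b → B c → a ≢ c → E a b → E b c → E a c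
    B-transitive {a} {b} {c} Ba Bb Bc a≢c ab bc with complete a c a≢c
    ... | inj₁ ac = ac
    ... | inj₂ ca = ⊥-elim (B-acyclic a b c Ba Bb Bc ab bc ca)

    autonomous-out : ∀ {b b' v} → B b → B b' → ¬ B v → E b v → E b' v
    autonomous-out Bb Bb' v∉B = Equivalence.to (B-autonomous _ _ _ Bb Bb' v∉B)

    autonomous-in : ∀ {b b' v} → B b → B b' → ¬ B v → E v b → E v b'
    autonomous-in {b} {b'} {v} Bb Bb' v∉B vb with complete v b' (λ { refl → v∉B Bb' })
    ... | inj₁ vb' = vb'
    ... | inj₂ b'v = ⊥-elim (antisym v b vb (autonomous-out Bb' Bb v∉B b'v))

    B-source : ∀ {n} (g : Fin (suc n) → V) → Injective _≡_ _≡_ g → (∀ i → B (g i)) → HasSource g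
    B-source {zero} g _ _ = zero , λ { zero 0≢0 → ⊥-elim (0≢0 refl) }
    B-source {suc n} g g-injective g∈B with B-source (g ∘ suc) (suc-injective ∘ g-injective) (g∈B ∘ suc)
    ... | k , k-beats with complete (g zero) (g (suc k)) (0≢1+n ∘ g-injective)
    ... | inj₂ k0 = suc k , λ
      { zero _ → k0
      ; (suc l) l≢k → k-beats l (l≢k ∘ cong suc) }
    ... | inj₁ 0k = zero , λ
      { zero 0≢0 → ⊥-elim (0≢0 refl)
      ; (suc l) _ → beats l }
      where
      beats : ∀ l → E (g zero) (g (suc l))
      beats l with l ≟ᶠ k
      ... | yes refl = 0k
      ... | no l≢k = B-transitive (g∈B zero) (g∈B (suc k)) (g∈B (suc l)) (0≢1+n ∘ g-injective) 0k (k-beats l l≢k)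

    Corresponds : V → V → Set
    Corresponds a a' = (¬ B a × a' ≡ a) ⊎ (B a × B a')

    corresponds-sym : ∀ {a a'} → Corresponds a a' → Corresponds a' a
    corresponds-sym (inj₁ (a∉B , refl)) = inj₁ (a∉B , refl)
    corresponds-sym (inj₂ (Ba , Ba')) = inj₂ (Ba' , Ba)

    corresponds-outside : ∀ {a a' v} → Corresponds a a' → ¬ B v → a ≡ v → a' ≡ v
    corresponds-outside (inj₁ (_ , refl)) _ a≡v = a≡v
    corresponds-outside (inj₂ (Ba , _)) v∉B refl = ⊥-elim (v∉B Ba)

    corresponds-edge : ∀ {a a' b b'} → Corresponds a a' → Corresponds b b' → (B a → B b → ⊥) → E a b → E a' b'
    corresponds-edge (inj₁ (_ , refl)) (inj₁ (_ , refl)) _ ab = ab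
    corresponds-edge (inj₁ (a∉B , refl)) (inj₂ (Bb , Bb')) _ ab = autonomous-in Bb Bb' a∉B ab
    corresponds-edge (inj₂ (Ba , Ba')) (inj₁ (b∉B , refl)) _ ab = autonomous-out Ba Ba' b∉B ab
    corresponds-edge (inj₂ (Ba , _)) (inj₂ (Bb , _)) not-both _ = ⊥-elim (not-both Ba Bb)

    _∈ˢ_ : ∀ {n} → V → FinSubset T n → Set
    v ∈ˢ X = _∈img_ T v X

    OutsideIncluded : ∀ {n} → FinSubset T n → FinSubset T n → Set
    OutsideIncluded X X' = ∀ v → (v ∈ˢ X) × ¬ B v → (v ∈ˢ X') × ¬ B v

    SameOutside : ∀ {n} → FinSubset T n → FinSubset T n → Set
    SameOutside X X' = ∀ v → ((v ∈ˢ X) × ¬ B v) ⇔ ((v ∈ˢ X') × ¬ B v)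

    remove : ∀ {n} → FinSubset T (suc n) → Fin (suc n) → FinSubset T n
    remove X i = record { elt = elt X ∘ punchIn i ; inj = punchIn-injective i _ _ ∘ inj X }

    remove-outsideIncluded : ∀ {n} {X X' : FinSubset T (suc n)} {i j} →
      OutsideIncluded X X' → Corresponds (elt X' j) (elt X i) → OutsideIncluded (remove X i) (remove X' j)
    remove-outsideIncluded {X = X} {X'} {i} {j} X⊆X' X'j~Xi v ((k , Xk≡v) , v∉B)
      with X⊆X' v ((punchIn i k , Xk≡v) , v∉B)
    ... | (l , X'l≡v) , _ with j ≟ᶠ l
    ... | yes refl = ⊥-elim (punchInᵢ≢i i k (inj X (trans Xk≡v (sym (corresponds-outside X'j~Xi v∉B X'l≡v)))))
    ... | no j≢l = (punchOut j≢l , trans (cong (elt X') (punchIn-punchOut j≢l)) X'l≡v) , v∉B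

    remove-sameOutside : ∀ {n} {X X' : FinSubset T (suc n)} {i j} →
      SameOutside X X' → Corresponds (elt X i) (elt X' j) → SameOutside (remove X i) (remove X' j)
    remove-sameOutside {X = X} {X'} {i} {j} same Xi~X'j v = mk⇔
      (remove-outsideIncluded {X = X} {X'} (λ w → Equivalence.to (same w)) (corresponds-sym Xi~X'j) v)
      (remove-outsideIncluded {X = X'} {X} (λ w → Equivalence.from (same w)) Xi~X'j v)

    Matching : ∀ {n} → FinSubset T n → FinSubset T n → Set
    Matching {n} X X' = Σ (Permutation n n) λ σ →
      (∀ i → Corresponds (elt X i) (elt X' (σ ⟨$⟩ʳ i))) ×
      (∀ i j → E (elt X i) (elt X j) → E (elt X' (σ ⟨$⟩ʳ i)) (elt X' (σ ⟨$⟩ʳ j)))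

    PivotCompatible : ∀ {n} → FinSubset T n → FinSubset T n → Fin n → Fin n → Set
    PivotCompatible X X' i₀ j₀ = ∀ i j → i ≢ i₀ → j ≢ j₀ → Corresponds (elt X i) (elt X' j) →
      (E (elt X i₀) (elt X i) → E (elt X' j₀) (elt X' j)) × (E (elt X i) (elt X i₀) → E (elt X' j) (elt X' j₀))

    matching-insert : ∀ {n} {X X' : FinSubset T (suc n)} {i₀ j₀} →
      Corresponds (elt X i₀) (elt X' j₀) → PivotCompatible X X' i₀ j₀ →
      Matching (remove X i₀) (remove X' j₀) → Matching X X'
    matching-insert {X = X} {X'} {i₀} {j₀} pivot compatible (σ , σ-corresponds , σ-edge) = τ , τ-corresponds , τ-edge
      where
      τ = insert i₀ j₀ σ

      τ-pivot : τ ⟨$⟩ʳ i₀ ≡ j₀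
      τ-pivot = insert-pivot i₀ j₀ σ

      τ-punchIn : ∀ k → τ ⟨$⟩ʳ punchIn i₀ k ≡ punchIn j₀ (σ ⟨$⟩ʳ k)
      τ-punchIn = insert-punchIn i₀ j₀ σ

      compatible-at : ∀ k →
        (E (elt X i₀) (elt X (punchIn i₀ k)) → E (elt X' j₀) (elt X' (punchIn j₀ (σ ⟨$⟩ʳ k)))) ×
        (E (elt X (punchIn i₀ k)) (elt X i₀) → E (elt X' (punchIn j₀ (σ ⟨$⟩ʳ k))) (elt X' j₀))
      compatible-at k = compatible (punchIn i₀ k) (punchIn j₀ (σ ⟨$⟩ʳ k))
        (punchInᵢ≢i i₀ k) (punchInᵢ≢i j₀ _) (σ-corresponds k)

      τ-corresponds : ∀ i → Corresponds (elt X i) (elt X' (τ ⟨$⟩ʳ i))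
      τ-corresponds i with ≡⊎punchIn i₀ i
      ... | inj₁ refl rewrite τ-pivot = pivot
      ... | inj₂ (k , refl) rewrite τ-punchIn k = σ-corresponds k

      τ-edge : ∀ i j → E (elt X i) (elt X j) → E (elt X' (τ ⟨$⟩ʳ i)) (elt X' (τ ⟨$⟩ʳ j))
      τ-edge i j ij with ≡⊎punchIn i₀ i | ≡⊎punchIn i₀ j
      ... | inj₁ refl | inj₁ refl = ⊥-elim (irrefl _ ij)
      ... | inj₁ refl | inj₂ (l , refl) rewrite τ-pivot | τ-punchIn l = proj₁ (compatible-at l) ij
      ... | inj₂ (k , refl) | inj₁ refl rewrite τ-pivot | τ-punchIn k = proj₂ (compatible-at k) ij
      ... | inj₂ (k , refl) | inj₂ (l , refl) rewrite τ-punchIn k | τ-punchIn l = σ-edge k l ij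

    -- Peel off a vertex outside B (matched with itself) if there is one;
    -- otherwise both sets lie in B and their sources are matched.
    matching : ∀ {n} (X X' : FinSubset T n) → SameOutside X X' → Matching X X'
    matching {zero} X X' _ = idₚ , (λ ()) , (λ ())
    matching {suc n} X X' same with any? (λ i → ¬? (B? (elt X i)))
    ... | yes (i₀ , Xi₀∉B) =
      let (j₀ , X'j₀≡Xi₀) , _ = Equivalence.to (same _) ((i₀ , refl) , Xi₀∉B)
          pivot = inj₁ (Xi₀∉B , X'j₀≡Xi₀)
      in matching-insert {X = X} {X'} {i₀} {j₀} pivot
           (λ _ _ _ _ i~j → corresponds-edge pivot i~j (λ Bi₀ _ → Xi₀∉B Bi₀) ,
                            corresponds-edge i~j pivot (λ _ Bi₀ → Xi₀∉B Bi₀))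
           (matching (remove X i₀) (remove X' j₀) (remove-sameOutside {X = X} {X'} {i₀} {j₀} same pivot))
    ... | no none =
      let i₀ , i₀-beats = B-source (elt X) (inj X) X⊆B
          j₀ , j₀-beats = B-source (elt X') (inj X') X'⊆B
          pivot = inj₂ (X⊆B i₀ , X'⊆B j₀)
      in matching-insert {X = X} {X'} {i₀} {j₀} pivot
           (λ i j i≢i₀ j≢j₀ _ → (λ _ → j₀-beats j j≢j₀) , (λ ii₀ → ⊥-elim (antisym _ _ ii₀ (i₀-beats i i≢i₀))))
           (matching (remove X i₀) (remove X' j₀) (remove-sameOutside {X = X} {X'} {i₀} {j₀} same pivot))
      where
      X⊆B : ∀ i → B (elt X i)
      X⊆B i = decidable-stable (B? (elt X i)) (λ Xi∉B → none (i , Xi∉B))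

      X'⊆B : ∀ j → B (elt X' j)
      X'⊆B j = decidable-stable (B? (elt X' j)) λ X'j∉B →
        let (i , Xi≡X'j) , _ = Equivalence.from (same _) ((j , refl) , X'j∉B)
        in X'j∉B (subst B Xi≡X'j (X⊆B i))

    acyclic-autonomous⇒monomorphic : MonomorphicPart T B
    acyclic-autonomous⇒monomorphic n X X' same =
      let σ , _ , σ-edge = matching X X' same
      in σ , λ i j → mk⇔ (σ-edge i j) (reflect σ σ-edge i j)
      where
      reflect : ∀ σ → (∀ i j → E (elt X i) (elt X j) → E (elt X' (σ ⟨$⟩ʳ i)) (elt X' (σ ⟨$⟩ʳ j))) →
        ∀ i j → E (elt X' (σ ⟨$⟩ʳ i)) (elt X' (σ ⟨$⟩ʳ j)) → E (elt X i) (elt X j)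
      reflect σ σ-edge i j σiσj with i ≟ᶠ j
      ... | yes refl = ⊥-elim (irrefl _ σiσj)
      ... | no i≢j with complete (elt X i) (elt X j) (i≢j ∘ inj X)
      ... | inj₁ ij = ij
      ... | inj₂ ji = ⊥-elim (antisym _ _ σiσj (σ-edge j i ji))

  acyclicComponent⊆monomorphicComponent : ({P : Set} → Dec P) → ∀ {x y} →
    AcyclicComponentOf T x y → MonomorphicComponentOf T x y
  acyclicComponent⊆monomorphicComponent decide (B , acyclic , autonomous , Bx , By) =
    B , acyclic-autonomous⇒monomorphic (λ _ → decide) acyclic autonomous , Bx , By

  module Hull (_≟_ : DecidableEquality V) {x : V} {S : Subset V} (x∈S : S x)
    (S⊆component : ∀ {v} → S v → MonomorphicComponentOf T x v)
    (f : Fin 4 → V) (f-injective : Injective _≡_ _≡_ f) (f∈S : ∀ i → S (f i)) where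

    ∉S⇒≢ : ∀ {w s} → ¬ S w → S s → w ≢ s
    ∉S⇒≢ w∉S s∈S refl = w∉S s∈S

    swap : ∀ {s t a c} → S s → S t → a ≢ c → a ≢ s → c ≢ s → a ≢ t → c ≢ t → Cyclic s a c → Cyclic t a c
    swap s∈S t∈S = component-swap-cyclic _≟_ (S⊆component s∈S) (S⊆component t∈S)

    cyclic-move-pair : ∀ {w s t s' t'} → ¬ S w → S s → S t → S s' → S t' → s' ≢ t' → Cyclic w s t → Cyclic w s' t'
    cyclic-move-pair {w} {s} {t} {s'} {t'} w∉S s∈S t∈S s'∈S t'∈S s'≢t' wst
      with t ≟ s' | cyclic⇒≢ (cyclic-rotate wst)
    ... | no t≢s' | s≢t =
      cyclic-rotate (swap t∈S t'∈S (∉S⇒≢ w∉S s'∈S) (∉S⇒≢ w∉S t∈S) (≢-sym t≢s') (∉S⇒≢ w∉S t'∈S) s'≢t'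
        (cyclic-rotate (swap s∈S s'∈S (≢-sym (∉S⇒≢ w∉S t∈S)) (≢-sym s≢t) (∉S⇒≢ w∉S s∈S) t≢s' (∉S⇒≢ w∉S s'∈S)
          (cyclic-rotate wst))))
    ... | yes refl | s≢t =
      cyclic-rotate (swap s∈S t'∈S (∉S⇒≢ w∉S t∈S) (∉S⇒≢ w∉S s∈S) (≢-sym s≢t) (∉S⇒≢ w∉S t'∈S) s'≢t'
        (cyclic-rotate (cyclic-rotate (cyclic-flip₂₃ wst))))

    ¬cyclic-outside : ∀ {w s t} → ¬ S w → S s → S t → ¬ Cyclic w s t
    ¬cyclic-outside {w} w∉S s∈S t∈S wst =
      ¬cyclic-with-all-pairs (move zero (suc zero) λ ()) (move zero (suc (suc zero)) λ ())
        (move (suc zero) (suc (suc zero)) λ ())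
      where
      move : ∀ i j → i ≢ j → Cyclic w (f i) (f j)
      move i j i≢j = cyclic-move-pair w∉S s∈S t∈S (f∈S i) (f∈S j) (i≢j ∘ f-injective) wst

    ¬cyclic-inside : ∀ {s t r} → S s → S t → S r → ¬ Cyclic s t r
    ¬cyclic-inside {s} {t} {r} s∈S t∈S r∈S str =
      ¬cyclic-with-all-pairs
        (swap r∈S u∈S s≢t (≢-sym r≢s) t≢r (≢-sym (u≢ zero)) (≢-sym (u≢ (suc zero))) (cyclic-rotate (cyclic-rotate str)))
        (swap t∈S u∈S (≢-sym r≢s) s≢t (≢-sym t≢r) (≢-sym (u≢ zero)) (≢-sym (u≢ (suc (suc zero)))) (cyclic-flip str))
        (swap s∈S u∈S t≢r (≢-sym s≢t) r≢s (≢-sym (u≢ (suc zero))) (≢-sym (u≢ (suc (suc zero)))) str)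
      where
      s≢t = cyclic⇒≢ str
      t≢r = cyclic⇒≢ (cyclic-rotate str)
      r≢s = cyclic⇒≢ (cyclic-rotate (cyclic-rotate str))
      avoider = injection-avoids _≟_ f f-injective (s ∷ t ∷ r ∷ [])
      u = f (proj₁ avoider)
      u∈S = f∈S (proj₁ avoider)
      u≢ : ∀ l → u ≢ (s ∷ t ∷ r ∷ []) l
      u≢ = proj₂ avoider

    Between : V → Set
    Between w = ¬ S w × ∃[ p ] ∃[ q ] (S p × S q × E p w × E w q)

    edge-into-outside : ∀ {s t w} → S s → S t → ¬ S w → E s t → E t w → E s w
    edge-into-outside {s} {t} {w} s∈S t∈S w∉S st tw with complete s w (≢-sym (∉S⇒≢ w∉S s∈S))
    ... | inj₁ sw = sw
    ... | inj₂ ws = ⊥-elim (¬cyclic-outside w∉S s∈S t∈S (inj₁ (ws , st , tw)))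

    edge-from-outside : ∀ {s t w} → S s → S t → ¬ S w → E s t → E w s → E w t
    edge-from-outside {s} {t} {w} s∈S t∈S w∉S st ws with complete w t (∉S⇒≢ w∉S t∈S)
    ... | inj₁ wt = wt
    ... | inj₂ tw = ⊥-elim (¬cyclic-outside w∉S s∈S t∈S (inj₁ (ws , st , tw)))

    lower-bound : ∀ {m w} → S m → Between w → ∃[ m' ] (S m' × E m' w × (∀ {v} → ¬ S v → E m v → E m' v))
    lower-bound {m} m∈S (w∉S , p , _ , p∈S , _ , pw , _) with m ≟ p
    ... | yes refl = m , m∈S , pw , λ _ → id
    ... | no m≢p with complete m p m≢p
    ... | inj₁ mp = m , m∈S , edge-into-outside m∈S p∈S w∉S mp pw , λ _ → id
    ... | inj₂ pm = p , p∈S , pw , λ v∉S → edge-into-outside p∈S m∈S v∉S pm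

    upper-bound : ∀ {m w} → S m → Between w → ∃[ m' ] (S m' × E w m' × (∀ {v} → ¬ S v → E v m → E v m'))
    upper-bound {m} m∈S (w∉S , _ , q , _ , q∈S , _ , wq) with m ≟ q
    ... | yes refl = m , m∈S , wq , λ _ → id
    ... | no m≢q with complete m q m≢q
    ... | inj₁ mq = q , q∈S , wq , λ v∉S → edge-from-outside m∈S q∈S v∉S mq
    ... | inj₂ qm = m , m∈S , edge-from-outside q∈S m∈S w∉S qm wq , λ _ → id

    common-lower-bound₂ : ∀ {w₁ w₂} → Between w₁ → Between w₂ → ∃[ m ] (S m × E m w₁ × E m w₂)
    common-lower-bound₂ b₁@(w₁∉S , p , _ , p∈S , _ , pw₁ , _) b₂ =
      let m , m∈S , mw₂ , below = lower-bound p∈S b₂ in m , m∈S , below w₁∉S pw₁ , mw₂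

    common-upper-bound₂ : ∀ {w₁ w₂} → Between w₁ → Between w₂ → ∃[ m ] (S m × E w₁ m × E w₂ m)
    common-upper-bound₂ b₁@(w₁∉S , _ , q , _ , q∈S , _ , w₁q) b₂ =
      let m , m∈S , w₂m , above = upper-bound q∈S b₂ in m , m∈S , above w₁∉S w₁q , w₂m

    common-lower-bound₃ : ∀ {w₁ w₂ w₃} → Between w₁ → Between w₂ → Between w₃ →
      ∃[ m ] (S m × E m w₁ × E m w₂ × E m w₃)
    common-lower-bound₃ b₁ b₂ b₃ =
      let m , m∈S , mw₁ , mw₂ = common-lower-bound₂ b₁ b₂
          m' , m'∈S , m'w₃ , below = lower-bound m∈S b₃
      in m' , m'∈S , below (proj₁ b₁) mw₁ , below (proj₁ b₂) mw₂ , m'w₃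

    common-upper-bound₃ : ∀ {w₁ w₂ w₃} → Between w₁ → Between w₂ → Between w₃ →
      ∃[ m ] (S m × E w₁ m × E w₂ m × E w₃ m)
    common-upper-bound₃ b₁ b₂ b₃ =
      let m , m∈S , w₁m , w₂m = common-upper-bound₂ b₁ b₂
          m' , m'∈S , w₃m' , above = upper-bound m∈S b₃
      in m' , m'∈S , above (proj₁ b₁) w₁m , above (proj₁ b₂) w₂m , w₃m'

    ¬cyclic-between₂ : ∀ {w₁ w₂ s} → Between w₁ → Between w₂ → S s → ¬ Cyclic w₁ w₂ s
    ¬cyclic-between₂ b₁@(w₁∉S , _) b₂@(w₂∉S , _) s∈S cyc =
      let m , m∈S , mw₁ , mw₂ = common-lower-bound₂ b₁ b₂
      in ¬cyclic-source
           (swap s∈S m∈S (cyclic⇒≢ cyc) (∉S⇒≢ w₁∉S s∈S) (∉S⇒≢ w₂∉S s∈S) (∉S⇒≢ w₁∉S m∈S) (∉S⇒≢ w₂∉S m∈S)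
             (cyclic-rotate (cyclic-rotate cyc)))
           mw₁ mw₂

    -- A common lower bound m is a source of {m, w₁, w₂, w₃}; exchanging it for a
    -- common upper bound would make the 3-cycle contain a source.
    ¬cyclic-between₃ : ∀ {w₁ w₂ w₃} → Between w₁ → Between w₂ → Between w₃ → ¬ Cyclic w₁ w₂ w₃
    ¬cyclic-between₃ {w₁} {w₂} {w₃} b₁ b₂ b₃ cyc
      with common-lower-bound₃ b₁ b₂ b₃ | common-upper-bound₃ b₁ b₂ b₃
    ... | m , m∈S , mw₁ , mw₂ , mw₃ | M , M∈S , w₁M , w₂M , w₃M =
      M-¬source (component-swap-source (S⊆component m∈S) (S⊆component M∈S) triple
        (avoids m∈S) (avoids M∈S) (avoids x∈S) m-source)
      where
      triple : FinSubset T 3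
      triple = addFresh w₁ (addFresh w₂ (addFresh w₃ emptyˢ λ ())
        λ { zero → cyclic⇒≢ (cyclic-rotate cyc) ∘ sym })
        λ { zero → cyclic⇒≢ cyc ∘ sym ; (suc zero) → cyclic⇒≢ (cyclic-rotate (cyclic-rotate cyc)) }

      avoids : ∀ {v} → S v → ∀ i → elt triple i ≢ v
      avoids v∈S zero = ∉S⇒≢ (proj₁ b₁) v∈S
      avoids v∈S (suc zero) = ∉S⇒≢ (proj₁ b₂) v∈S
      avoids v∈S (suc (suc zero)) = ∉S⇒≢ (proj₁ b₃) v∈S

      m-source : HasSource (m ∷ elt triple)
      m-source = zero , λ
        { zero 0≢0 → ⊥-elim (0≢0 refl)
        ; (suc zero) _ → mw₁
        ; (suc (suc zero)) _ → mw₂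
        ; (suc (suc (suc zero))) _ → mw₃ }

      M-¬source : ¬ HasSource (M ∷ elt triple)
      M-¬source (zero , beats) = antisym _ _ w₁M (beats (suc zero) λ ())
      M-¬source (suc zero , beats) =
        ¬cyclic-source cyc (beats (suc (suc zero)) λ ()) (beats (suc (suc (suc zero))) λ ())
      M-¬source (suc (suc zero) , beats) =
        ¬cyclic-source (cyclic-rotate cyc) (beats (suc (suc (suc zero))) λ ()) (beats (suc zero) λ ())
      M-¬source (suc (suc (suc zero)) , beats) =
        ¬cyclic-source (cyclic-rotate (cyclic-rotate cyc)) (beats (suc zero) λ ()) (beats (suc (suc zero)) λ ())

    hull : Subset V
    hull v = S v ⊎ Between v

    ¬cyclic-hull : ∀ {a b c} → hull a → hull b → hull c → ¬ Cyclic a b c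
    ¬cyclic-hull (inj₁ a) (inj₁ b) (inj₁ c) = ¬cyclic-inside a b c
    ¬cyclic-hull (inj₂ a) (inj₁ b) (inj₁ c) = ¬cyclic-outside (proj₁ a) b c
    ¬cyclic-hull (inj₁ a) (inj₂ b) (inj₁ c) = ¬cyclic-outside (proj₁ b) c a ∘ cyclic-rotate
    ¬cyclic-hull (inj₁ a) (inj₁ b) (inj₂ c) = ¬cyclic-outside (proj₁ c) a b ∘ cyclic-rotate ∘ cyclic-rotate
    ¬cyclic-hull (inj₂ a) (inj₂ b) (inj₁ c) = ¬cyclic-between₂ a b c
    ¬cyclic-hull (inj₂ a) (inj₁ b) (inj₂ c) = ¬cyclic-between₂ c a b ∘ cyclic-rotate ∘ cyclic-rotate
    ¬cyclic-hull (inj₁ a) (inj₂ b) (inj₂ c) = ¬cyclic-between₂ b c a ∘ cyclic-rotate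
    ¬cyclic-hull (inj₂ a) (inj₂ b) (inj₂ c) = ¬cyclic-between₃ a b c

    hull-acyclic : Acyclic T hull
    hull-acyclic _ _ _ a b c ab bc ca = ¬cyclic-hull a b c (inj₁ (ab , bc , ca))

    hull-beaten : ∀ {u} → ¬ hull u → E x u → ∀ {c} → hull c → E c u
    hull-beaten {u} u∉hull xu (inj₁ c∈S) = S-beaten c∈S
      where
      S-beaten : ∀ {s} → S s → E s u
      S-beaten {s} s∈S with complete s u (≢-sym (∉S⇒≢ (u∉hull ∘ inj₁) s∈S))
      ... | inj₁ su = su
      ... | inj₂ us = ⊥-elim (u∉hull (inj₂ (u∉hull ∘ inj₁ , x , s , x∈S , s∈S , xu , us)))
    hull-beaten {u} u∉hull xu {w} (inj₂ b@(w∉S , p , q , p∈S , q∈S , pw , wq))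
      with complete w u (λ { refl → u∉hull (inj₂ b) })
    ... | inj₁ wu = wu
    ... | inj₂ uw = ⊥-elim (¬cyclic-source
          (swap q∈S p∈S (E⇒≢ uw) (∉S⇒≢ u∉S q∈S) (∉S⇒≢ w∉S q∈S) (∉S⇒≢ u∉S p∈S) (∉S⇒≢ w∉S p∈S)
            (cyclic-rotate (cyclic-rotate (inj₁ (uw , wq , hull-beaten u∉hull xu (inj₁ q∈S))))))
          (hull-beaten u∉hull xu (inj₁ p∈S)) pw)
      where
      u∉S : ¬ S u
      u∉S = u∉hull ∘ inj₁

    hull-beats : ∀ {u} → ¬ hull u → E u x → ∀ {c} → hull c → E u c
    hull-beats {u} u∉hull ux (inj₁ c∈S) = S-beats c∈S
      where
      S-beats : ∀ {s} → S s → E u s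
      S-beats {s} s∈S with complete u s (∉S⇒≢ (u∉hull ∘ inj₁) s∈S)
      ... | inj₁ us = us
      ... | inj₂ su = ⊥-elim (u∉hull (inj₂ (u∉hull ∘ inj₁ , s , x , s∈S , x∈S , su , ux)))
    hull-beats {u} u∉hull ux {w} (inj₂ b@(w∉S , p , q , p∈S , q∈S , pw , wq))
      with complete u w (λ { refl → u∉hull (inj₂ b) })
    ... | inj₁ uw = uw
    ... | inj₂ wu = ⊥-elim (¬cyclic-sink
          (swap p∈S q∈S (E⇒≢ wu) (∉S⇒≢ w∉S p∈S) (∉S⇒≢ u∉S p∈S) (∉S⇒≢ w∉S q∈S) (∉S⇒≢ u∉S q∈S)
            (inj₁ (pw , wu , hull-beats u∉hull ux (inj₁ p∈S))))
          wq (hull-beats u∉hull ux (inj₁ q∈S)))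
      where
      u∉S : ¬ S u
      u∉S = u∉hull ∘ inj₁

    hull-autonomous : Autonomous T hull
    hull-autonomous c c' u c∈hull c'∈hull u∉hull with complete x u (λ { refl → u∉hull (inj₁ x∈S) })
    ... | inj₁ xu = mk⇔ (λ _ → hull-beaten u∉hull xu c'∈hull) (λ _ → hull-beaten u∉hull xu c∈hull)
    ... | inj₂ ux = mk⇔ (λ cu → ⊥-elim (antisym _ _ cu (hull-beats u∉hull ux c∈hull)))
                        (λ c'u → ⊥-elim (antisym _ _ c'u (hull-beats u∉hull ux c'∈hull)))

  monomorphicComponent-centre : ∀ {x v} → MonomorphicComponentOf T x v → MonomorphicComponentOf T x x
  monomorphicComponent-centre (B , mono , Bx , _) = B , mono , Bx , Bx

  acyclicComponent-centre : ∀ {x v} → AcyclicComponentOf T x v → AcyclicComponentOf T x x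
  acyclicComponent-centre (B , acyclic , autonomous , Bx , _) = B , acyclic , autonomous , Bx , Bx

  large-subset⊆acyclicComponent : DecidableEquality V → ∀ {x} {S : Subset V} → S x →
    (∀ {v} → S v → MonomorphicComponentOf T x v) → AtLeast 4 S → ∀ {y} → S y → AcyclicComponentOf T x y
  large-subset⊆acyclicComponent _≟_ x∈S S⊆component (f , f-injective , f∈S) y∈S =
    hull , hull-acyclic , hull-autonomous , inj₁ x∈S , inj₁ y∈S
    where open Hull _≟_ x∈S S⊆component f f-injective f∈S

corollary3p15 : ExcludedMiddle (lsuc 0ℓ) → {V : Set} (T : Tournament V) (A : Subset V) →
    AtLeast 4 A →
    IsAcyclicComponent T A ⇔ IsMonomorphicComponent T A
corollary3p15 em T A (f , f-injective , f∈A) = mk⇔ acyclic⇒monomorphic monomorphic⇒acyclic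
  where
  decide : {P : Set} → Dec P
  decide = map′ lower lift em

  -- y need not lie in A, so it is added to the large set.
  monomorphic⊆acyclic : ∀ {x y} → A x → (∀ {v} → A v → MonomorphicComponentOf T x v) →
    MonomorphicComponentOf T x y → AcyclicComponentOf T x y
  monomorphic⊆acyclic {y = y} Ax A⊆component y∈component =
    large-subset⊆acyclicComponent T (λ _ _ → decide) {S = λ v → A v ⊎ v ≡ y} (inj₁ Ax)
      (λ { (inj₁ Av) → A⊆component Av ; (inj₂ refl) → y∈component })
      (f , f-injective , inj₁ ∘ f∈A) (inj₂ refl)

  acyclic⇒monomorphic : IsAcyclicComponent T A → IsMonomorphicComponent T A
  acyclic⇒monomorphic (x , A⇔acyclic) = x , λ y →
    mk⇔ A⊆component (Equivalence.from (A⇔acyclic y) ∘ monomorphic⊆acyclic Ax A⊆component)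
    where
    A⊆component : ∀ {v} → A v → MonomorphicComponentOf T x v
    A⊆component {v} = acyclicComponent⊆monomorphicComponent T decide ∘ Equivalence.to (A⇔acyclic v)
    Ax : A x
    Ax = Equivalence.from (A⇔acyclic x)
           (acyclicComponent-centre T (Equivalence.to (A⇔acyclic (f zero)) (f∈A zero)))

  monomorphic⇒acyclic : IsMonomorphicComponent T A → IsAcyclicComponent T A
  monomorphic⇒acyclic (x , A⇔monomorphic) = x , λ y →
    mk⇔ (monomorphic⊆acyclic Ax A⊆component ∘ A⊆component)
        (Equivalence.from (A⇔monomorphic y) ∘ acyclicComponent⊆monomorphicComponent T decide)
    where
    A⊆component : ∀ {v} → A v → MonomorphicComponentOf T x v
    A⊆component {v} = Equivalence.to (A⇔monomorphic v)
    Ax : A x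
    Ax = Equivalence.from (A⇔monomorphic x) (monomorphicComponent-centre T (A⊆component (f∈A zero)))
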